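{- There exists a deterministic algorithm that, given any pairwise disjoint subsets $A,B,C \subset V(G)$ of any graph $G$ with $n=|V(G)|$ and access to the TIS oracle of $G$, determines the exact value of $t(A,B,C)$ using $\mathcal{O}(t(A,B,C)\log n)$ TIS queries.
   Context: For pairwise disjoint non-empty $A,B,C\subseteq V(G)$, $t(A,B,C)$ is the number of triangles of $G$ with exactly one vertex in each of $A,B,C$. The TIS (Tripartite Independent Set) oracle takes pairwise disjoint non-empty $V_1,V_2,V_3\subseteq V(G)$ and answers YES iff $t(V_1,V_2,V_3)\neq 0$. -}

module Defs where

open import Data.Bool using (Bool; true; false; _∧_; not; if_then_else_)
open import Data.Nat using (ℕ; zero; suc; _+_; _≡ᵇ_)
open import Data.Fin using (Fin)
open import Data.Fin.Subset using (Subset; _∩_; Empty)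
open import Data.Fin.Subset.Properties using (nonempty?)
open import Data.Vec using (lookup)
open import Data.List using (List; map)
open import Data.Nat.ListAction using (sum)
open import Data.List using (allFin)
open import Data.Maybe using (Maybe; just; nothing)
open import Data.Product using (_×_; _,_)
open import Relation.Nullary using (does)
open import Relation.Binary.PropositionalEquality using (_≡_)

record Graph (n : ℕ) : Set where
  field
    adj     : Fin n → Fin n → Bool
    sym     : ∀ x y → adj x y ≡ adj y x
    irrefl  : ∀ x → adj x x ≡ false
open Graph public

Disjoint : {n : ℕ} → Subset n → Subset n → Set
Disjoint p q = Empty (p ∩ q)

Σfin : (n : ℕ) → (Fin n → ℕ) → ℕ
Σfin n f = sum (map f (allFin n))

indicator : Bool → ℕ
indicator true  = 1
indicator false = 0

-- t(A,B,C): number of triangles with exactly one vertex in each of A, B, C.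
-- For pairwise disjoint A, B, C each such triangle {a,b,c} corresponds to exactly
-- one ordered triple (a,b,c) ∈ A × B × C of pairwise adjacent vertices.
t : {n : ℕ} → Graph n → Subset n → Subset n → Subset n → ℕ
t {n} G A B C =
  Σfin n λ a → Σfin n λ b → Σfin n λ c →
    indicator (lookup A a ∧ lookup B b ∧ lookup C c
               ∧ adj G a b ∧ adj G b c ∧ adj G a c)

-- Deterministic query algorithms (decision trees) over TIS queries on Fin n:
-- either stop with an output, or ask the TIS oracle about (V₁,V₂,V₃) and
-- continue depending on the YES/NO answer.
data Alg (n : ℕ) : Set where
  done  : ℕ → Alg n
  query : Subset n → Subset n → Subset n → (Bool → Alg n) → Alg n

legal : {n : ℕ} → Subset n → Subset n → Subset n → Bool
legal V₁ V₂ V₃ =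
  does (nonempty? V₁) ∧ does (nonempty? V₂) ∧ does (nonempty? V₃)
  ∧ not (does (nonempty? (V₁ ∩ V₂)))
  ∧ not (does (nonempty? (V₁ ∩ V₃)))
  ∧ not (does (nonempty? (V₂ ∩ V₃)))

TIS : {n : ℕ} → Graph n → Subset n → Subset n → Subset n → Bool
TIS G V₁ V₂ V₃ = not (t G V₁ V₂ V₃ ≡ᵇ 0)

run : {n : ℕ} → Graph n → Alg n → Maybe (ℕ × ℕ)
run G (done k) = just (k , 0)
run G (query V₁ V₂ V₃ k) with legal V₁ V₂ V₃
... | false = nothing
... | true with run G (k (TIS G V₁ V₂ V₃))
...   | nothing = nothing
...   | just (out , q) = just (out , suc q)

-- Ask the oracle whether t(A,B,C) ≠ 0; if so, halve A (later B, then C) and recurse on both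
-- halves, adding the two counts. Since t is additive under such a split, this is exact, and
-- once every part has size at most 1 a YES answer means t = 1. With parts of size at most
-- 2^ka, 2^kb, 2^kc, induction on k = ka + kb + kc shows that at most 1 + 2kt queries are
-- made: a NO answer costs one query, and a YES answer at k + 1 costs
-- 1 + (1 + 2k·t₁) + (1 + 2k·t₂) ≤ 1 + 2(k + 1)t because t = t₁ + t₂ ≥ 1.
-- Starting from k = 3⌈log₂ n⌉ gives O(t log n).

module Submission where

open import Defs hiding (sym)
open import Data.Bool using (Bool; true; false; _∧_; if_then_else_)
open import Data.Fin using (Fin; zero; suc)
open import Data.Fin.Subset using (Subset; inside; outside; _⊆_; _∩_; ∣_∣; Nonempty)
open import Data.Fin.Subset.Properties using (nonempty?; x∈p∩q⁺; x∈p∩q⁻; Empty-unique; ∣⊥∣≡0; ∣p∣≤n)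
open import Data.List using (map; tabulate)
open import Data.Maybe using (just)
open import Data.Nat
  using (ℕ; zero; suc; _+_; _*_; _^_; _≤_; _<_; _≟_; ⌈_/2⌉; ⌊_/2⌋; z≤n; s≤s; NonZero; >-nonZero; ≢-nonZero⁻¹)
open import Data.Nat.Induction using (<-rec)
open import Data.Nat.ListAction using (sum)
open import Data.Nat.Logarithm using (⌈log₂_⌉; ⌈log₂⌉-mono-≤; ⌈log₂⌈n/2⌉⌉≡⌈log₂n⌉∸1)
open import Data.Nat.Properties hiding (_≟_)
open import Data.Nat.Tactic.RingSolver using (solve-∀)
open import Data.Product using (Σ; ∃; _×_; _,_)
open import Data.Vec using ([]; _∷_; lookup)
open import Data.Vec.Functional using (Vector)
open import Data.Vec.Properties using (lookup⇒[]=; []=⇒lookup)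
open import Function using (id; _∘_)
open import Relation.Binary.PropositionalEquality
open import Relation.Nullary using (yes; no; _×-dec_)
open import Relation.Nullary.Decidable using (dec-true; dec-false; decidable-stable)
open import Algebra.Properties.Semiring.Sum +-*-semiring
  using (sum-syntax; sum-cong-≗; ∑-distrib-+; *-distribˡ-sum; *-distribʳ-sum) renaming (sum to ∑)

private
  variable
    n : ℕ
    x l r : Bool

sum-map-tabulate : ∀ {A : Set} (f : A → ℕ) (g : Fin n → A) → sum (map f (tabulate g)) ≡ ∑[ i < n ] f (g i)
sum-map-tabulate {zero}  f g = refl
sum-map-tabulate {suc n} f g = cong (f (g zero) +_) (sum-map-tabulate f (g ∘ suc))

Σfin≡∑ : ∀ n (f : Fin n → ℕ) → Σfin n f ≡ ∑[ i < n ] f i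
Σfin≡∑ n f = sum-map-tabulate f id

∑-mono-≤ : {f g : Vector ℕ n} → (∀ i → f i ≤ g i) → ∑ f ≤ ∑ g
∑-mono-≤ {zero}  f≤g = z≤n
∑-mono-≤ {suc n} f≤g = +-mono-≤ (f≤g zero) (∑-mono-≤ (f≤g ∘ suc))

∑-cong-+ : {f g h : Vector ℕ n} → (∀ i → f i ≡ g i + h i) → ∑ f ≡ ∑ g + ∑ h
∑-cong-+ {g = g} {h} f≡g+h = trans (sum-cong-≗ f≡g+h) (∑-distrib-+ g h)

∑-factorˡ : ∀ k (f : Vector ℕ n) → ∑[ i < n ] (k * f i) ≡ k * ∑ f
∑-factorˡ k f = sym (*-distribˡ-sum k f)

∑-factorʳ : ∀ k (f : Vector ℕ n) → ∑[ i < n ] (f i * k) ≡ ∑ f * k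
∑-factorʳ k f = sym (*-distribʳ-sum k f)

∑-indicator≡∣p∣ : (p : Subset n) → ∑[ i < n ] indicator (lookup p i) ≡ ∣ p ∣
∑-indicator≡∣p∣ []            = refl
∑-indicator≡∣p∣ (outside ∷ p) = ∑-indicator≡∣p∣ p
∑-indicator≡∣p∣ (inside  ∷ p) = cong suc (∑-indicator≡∣p∣ p)

∑³ : (Fin n → Fin n → Fin n → ℕ) → ℕ
∑³ {n} f = ∑[ a < n ] ∑[ b < n ] ∑[ c < n ] f a b c

∑³-cong-+ : {f : Fin n → Fin n → Fin n → ℕ} (g h : Fin n → Fin n → Fin n → ℕ) →
  (∀ a b c → f a b c ≡ g a b c + h a b c) → ∑³ f ≡ ∑³ g + ∑³ h
∑³-cong-+ g h e = ∑-cong-+ λ a → ∑-cong-+ λ b → ∑-cong-+ (e a b)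

∑³-mono-≤ : {f g : Fin n → Fin n → Fin n → ℕ} → (∀ a b c → f a b c ≤ g a b c) → ∑³ f ≤ ∑³ g
∑³-mono-≤ f≤g = ∑-mono-≤ λ a → ∑-mono-≤ λ b → ∑-mono-≤ (f≤g a b)

∑³-product : (f g h : Vector ℕ n) → ∑³ (λ a b c → f a * (g b * h c)) ≡ ∑ f * (∑ g * ∑ h)
∑³-product {n} f g h = begin
  ∑[ a < n ] ∑[ b < n ] ∑[ c < n ] (f a * (g b * h c))
    ≡⟨ sum-cong-≗ (λ a → sum-cong-≗ λ b →
         trans (∑-factorˡ (f a) (λ c → g b * h c)) (cong (f a *_) (∑-factorˡ (g b) h))) ⟩
  ∑[ a < n ] ∑[ b < n ] (f a * (g b * ∑ h))
    ≡⟨ sum-cong-≗ (λ a → trans (∑-factorˡ (f a) (λ b → g b * ∑ h)) (cong (f a *_) (∑-factorʳ (∑ h) g))) ⟩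
  ∑[ a < n ] (f a * (∑ g * ∑ h))
    ≡⟨ ∑-factorʳ _ f ⟩
  ∑ f * (∑ g * ∑ h) ∎
  where open ≡-Reasoning

data Split : Bool → Bool → Bool → Set where
  neither : Split false false false
  left    : Split true true false
  right   : Split true false true

Split-swap : Split x l r → Split x r l
Split-swap neither = neither
Split-swap left    = right
Split-swap right   = left

Split-∧ˡ : ∀ y → Split x l r → Split (y ∧ x) (y ∧ l) (y ∧ r)
Split-∧ˡ true  s = s
Split-∧ˡ false s = neither

Split-∧ʳ : ∀ y → Split x l r → Split (x ∧ y) (l ∧ y) (r ∧ y)
Split-∧ʳ y     neither = neither
Split-∧ʳ true  left    = left
Split-∧ʳ false left    = neither
Split-∧ʳ true  right   = right
Split-∧ʳ false right   = neither

indicator-Split : Split x l r → indicator x ≡ indicator l + indicator r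
indicator-Split neither = refl
indicator-Split left    = refl
indicator-Split right   = refl

Split-left : Split x l r → l ≡ true → x ≡ true
Split-left left refl = refl

Splits : Subset n → Subset n → Subset n → Set
Splits p q q′ = ∀ i → Split (lookup p i) (lookup q i) (lookup q′ i)

Splits⇒⊆ : {p q q′ : Subset n} → Splits p q q′ → q ⊆ p
Splits⇒⊆ {p = p} s {i} i∈q = lookup⇒[]= i p (Split-left (s i) ([]=⇒lookup i∈q))

halfˡ halfʳ : Subset n → Subset n
halfˡ []            = []
halfˡ (outside ∷ p) = outside ∷ halfˡ p
halfˡ (inside  ∷ p) = inside  ∷ halfʳ p
halfʳ []            = []
halfʳ (outside ∷ p) = outside ∷ halfʳ p
halfʳ (inside  ∷ p) = outside ∷ halfˡ p

halves-Splits : (p : Subset n) → Splits p (halfˡ p) (halfʳ p)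
halves-Splits (outside ∷ p) zero    = neither
halves-Splits (outside ∷ p) (suc i) = halves-Splits p i
halves-Splits (inside  ∷ p) zero    = left
halves-Splits (inside  ∷ p) (suc i) = Split-swap (halves-Splits p i)

∣halfˡ∣≡⌈∣p∣/2⌉ : (p : Subset n) → ∣ halfˡ p ∣ ≡ ⌈ ∣ p ∣ /2⌉
∣halfʳ∣≡⌊∣p∣/2⌋ : (p : Subset n) → ∣ halfʳ p ∣ ≡ ⌊ ∣ p ∣ /2⌋
∣halfˡ∣≡⌈∣p∣/2⌉ []            = refl
∣halfˡ∣≡⌈∣p∣/2⌉ (outside ∷ p) = ∣halfˡ∣≡⌈∣p∣/2⌉ p
∣halfˡ∣≡⌈∣p∣/2⌉ (inside  ∷ p) = cong suc (∣halfʳ∣≡⌊∣p∣/2⌋ p)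
∣halfʳ∣≡⌊∣p∣/2⌋ []            = refl
∣halfʳ∣≡⌊∣p∣/2⌋ (outside ∷ p) = ∣halfʳ∣≡⌊∣p∣/2⌋ p
∣halfʳ∣≡⌊∣p∣/2⌋ (inside  ∷ p) = ∣halfˡ∣≡⌈∣p∣/2⌉ p

⌈m/2⌉≤2^k : ∀ {m} k → m ≤ 2 ^ suc k → ⌈ m /2⌉ ≤ 2 ^ k
⌈m/2⌉≤2^k {m} k m≤2^[1+k] = begin
  ⌈ m /2⌉              ≤⟨ ⌈n/2⌉-mono (≤-trans m≤2^[1+k] (≤-reflexive (cong (2 ^ k +_) (+-identityʳ (2 ^ k))))) ⟩
  ⌈ 2 ^ k + 2 ^ k /2⌉  ≡⟨ n≡⌈n+n/2⌉ (2 ^ k) ⟨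
  2 ^ k                ∎
  where open ≤-Reasoning

record Halving (h : Subset n → Subset n) : Set where
  field
    half⊆    : ∀ p → h p ⊆ p
    ∣half∣≤  : ∀ k p → ∣ p ∣ ≤ 2 ^ suc k → ∣ h p ∣ ≤ 2 ^ k

halfˡ-Halving : Halving {n} halfˡ
halfˡ-Halving = record
  { half⊆   = λ p → Splits⇒⊆ {q′ = halfʳ p} (halves-Splits p)
  ; ∣half∣≤ = λ k p ∣p∣≤ → subst (_≤ 2 ^ k) (sym (∣halfˡ∣≡⌈∣p∣/2⌉ p)) (⌈m/2⌉≤2^k k ∣p∣≤)
  }

halfʳ-Halving : Halving {n} halfʳ
halfʳ-Halving = record
  { half⊆   = λ p → Splits⇒⊆ {q′ = halfˡ p} (Split-swap ∘ halves-Splits p)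
  ; ∣half∣≤ = λ k p ∣p∣≤ → subst (_≤ 2 ^ k) (sym (∣halfʳ∣≡⌊∣p∣/2⌋ p))
                               (≤-trans (⌊n/2⌋≤⌈n/2⌉ ∣ p ∣) (⌈m/2⌉≤2^k k ∣p∣≤))
  }

n≤2^⌈log₂n⌉ : ∀ n → n ≤ 2 ^ ⌈log₂ n ⌉
n≤2^⌈log₂n⌉ = <-rec (λ n → n ≤ 2 ^ ⌈log₂ n ⌉) step
  where
  step : ∀ n → (∀ {m} → m < n → m ≤ 2 ^ ⌈log₂ m ⌉) → n ≤ 2 ^ ⌈log₂ n ⌉
  step zero             _  = z≤n
  step (suc zero)       _  = s≤s z≤n
  step n@(suc (suc m))  ih = begin
    n                  ≡⟨ ⌊n/2⌋+⌈n/2⌉≡n n ⟨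
    ⌊ n /2⌋ + ⌈ n /2⌉  ≤⟨ +-monoˡ-≤ ⌈ n /2⌉ (⌊n/2⌋≤⌈n/2⌉ n) ⟩
    ⌈ n /2⌉ + ⌈ n /2⌉  ≤⟨ +-mono-≤ ⌈n/2⌉≤2^k ⌈n/2⌉≤2^k ⟩
    2 ^ k + 2 ^ k      ≡⟨ cong (2 ^ k +_) (+-identityʳ (2 ^ k)) ⟨
    2 ^ suc k          ≡⟨ cong (2 ^_) suc-k≡⌈log₂n⌉ ⟩
    2 ^ ⌈log₂ n ⌉      ∎
    where
    open ≤-Reasoning
    k : ℕ
    k = ⌈log₂ ⌈ n /2⌉ ⌉
    ⌈n/2⌉≤2^k : ⌈ n /2⌉ ≤ 2 ^ k
    ⌈n/2⌉≤2^k = ih (⌈n/2⌉<n m)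
    suc-k≡⌈log₂n⌉ : suc k ≡ ⌈log₂ n ⌉
    suc-k≡⌈log₂n⌉ = trans (cong suc (⌈log₂⌈n/2⌉⌉≡⌈log₂n⌉∸1 n))
                          (m+[n∸m]≡n (⌈log₂⌉-mono-≤ {2} {n} (s≤s (s≤s z≤n))))

Disjoint-⊆ : {p p′ q q′ : Subset n} → p′ ⊆ p → q′ ⊆ q → Disjoint p q → Disjoint p′ q′
Disjoint-⊆ {p′ = p′} {q′ = q′} p′⊆p q′⊆q p∩q=∅ (i , i∈p′∩q′) =
  let i∈p′ , i∈q′ = x∈p∩q⁻ p′ q′ i∈p′∩q′ in p∩q=∅ (i , x∈p∩q⁺ (p′⊆p i∈p′ , q′⊆q i∈q′))

legal-true : {A B C : Subset n} → Nonempty A → Nonempty B → Nonempty C →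
  Disjoint A B → Disjoint A C → Disjoint B C → legal A B C ≡ true
legal-true {A = A} {B} {C} a b c A#B A#C B#C
  rewrite dec-true (nonempty? A) a | dec-true (nonempty? B) b | dec-true (nonempty? C) c
        | dec-false (nonempty? (A ∩ B)) A#B | dec-false (nonempty? (A ∩ C)) A#C
        | dec-false (nonempty? (B ∩ C)) B#C = refl

nonempty-if-∣p∣≢0 : {p : Subset n} → ∣ p ∣ ≢ 0 → Nonempty p
nonempty-if-∣p∣≢0 {n} {p} ∣p∣≢0 =
  decidable-stable (nonempty? p) λ p=∅ → ∣p∣≢0 (trans (cong ∣_∣ (Empty-unique p=∅)) (∣⊥∣≡0 n))

record Admissible (ka kb kc : ℕ) (A B C : Subset n) : Set where
  field
    A#B : Disjoint A B
    A#C : Disjoint A C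
    B#C : Disjoint B C
    ∣A∣≤ : ∣ A ∣ ≤ 2 ^ ka
    ∣B∣≤ : ∣ B ∣ ≤ 2 ^ kb
    ∣C∣≤ : ∣ C ∣ ≤ 2 ^ kc

module _ {h : Subset n → Subset n} (H : Halving h) {ka kb kc : ℕ} {A B C : Subset n} where
  open Halving H
  open Admissible

  Admissible-halve₁ : Admissible (suc ka) kb kc A B C → Admissible ka kb kc (h A) B C
  Admissible-halve₁ adm = record
    { A#B = Disjoint-⊆ (half⊆ A) id (A#B adm) ; A#C = Disjoint-⊆ (half⊆ A) id (A#C adm) ; B#C = B#C adm
    ; ∣A∣≤ = ∣half∣≤ ka A (∣A∣≤ adm) ; ∣B∣≤ = ∣B∣≤ adm ; ∣C∣≤ = ∣C∣≤ adm }

  Admissible-halve₂ : Admissible ka (suc kb) kc A B C → Admissible ka kb kc A (h B) C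
  Admissible-halve₂ adm = record
    { A#B = Disjoint-⊆ id (half⊆ B) (A#B adm) ; A#C = A#C adm ; B#C = Disjoint-⊆ (half⊆ B) id (B#C adm)
    ; ∣A∣≤ = ∣A∣≤ adm ; ∣B∣≤ = ∣half∣≤ kb B (∣B∣≤ adm) ; ∣C∣≤ = ∣C∣≤ adm }

  Admissible-halve₃ : Admissible ka kb (suc kc) A B C → Admissible ka kb kc A B (h C)
  Admissible-halve₃ adm = record
    { A#B = A#B adm ; A#C = Disjoint-⊆ id (half⊆ C) (A#C adm) ; B#C = Disjoint-⊆ id (half⊆ C) (B#C adm)
    ; ∣A∣≤ = ∣A∣≤ adm ; ∣B∣≤ = ∣B∣≤ adm ; ∣C∣≤ = ∣half∣≤ kc C (∣C∣≤ adm) }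

indicator-∧≤ : ∀ x y z w → indicator (x ∧ y ∧ z ∧ w) ≤ indicator x * (indicator y * indicator z)
indicator-∧≤ false y     z     w = z≤n
indicator-∧≤ true  false z     w = z≤n
indicator-∧≤ true  true  false w = z≤n
indicator-∧≤ true  true  true  w with w
... | true  = ≤-refl
... | false = z≤n

module _ {n : ℕ} (G : Graph n) where

  triangle : Subset n → Subset n → Subset n → Fin n → Fin n → Fin n → Bool
  triangle A B C a b c = lookup A a ∧ lookup B b ∧ lookup C c ∧ adj G a b ∧ adj G b c ∧ adj G a c

  t≡∑³ : ∀ A B C → t G A B C ≡ ∑³ (λ a b c → indicator (triangle A B C a b c))
  t≡∑³ A B C = trans (Σfin≡∑ n λ a → Σfin n λ b → Σfin n (f a b))
                     (sum-cong-≗ λ a → trans (Σfin≡∑ n λ b → Σfin n (f a b)) (sum-cong-≗ λ b → Σfin≡∑ n (f a b)))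
    where
    f : Fin n → Fin n → Fin n → ℕ
    f a b c = indicator (triangle A B C a b c)

  t-additive : ∀ {X Y Z X₁ Y₁ Z₁ X₂ Y₂ Z₂} →
    (∀ a b c → Split (triangle X Y Z a b c) (triangle X₁ Y₁ Z₁ a b c) (triangle X₂ Y₂ Z₂ a b c)) →
    t G X Y Z ≡ t G X₁ Y₁ Z₁ + t G X₂ Y₂ Z₂
  t-additive {X} {Y} {Z} {X₁} {Y₁} {Z₁} {X₂} {Y₂} {Z₂} s = begin
    t G X Y Z                       ≡⟨ t≡∑³ X Y Z ⟩
    ∑³ (λ a b c → indicator (triangle X Y Z a b c))
      ≡⟨ ∑³-cong-+ _ _ (λ a b c → indicator-Split (s a b c)) ⟩
    ∑³ (λ a b c → indicator (triangle X₁ Y₁ Z₁ a b c)) + ∑³ (λ a b c → indicator (triangle X₂ Y₂ Z₂ a b c))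
      ≡⟨ cong₂ _+_ (t≡∑³ X₁ Y₁ Z₁) (t≡∑³ X₂ Y₂ Z₂) ⟨
    t G X₁ Y₁ Z₁ + t G X₂ Y₂ Z₂     ∎
    where open ≡-Reasoning

  t-halves₁ : ∀ A B C → t G A B C ≡ t G (halfˡ A) B C + t G (halfʳ A) B C
  t-halves₁ A B C = t-additive {A} {B} {C} {halfˡ A} {B} {C} {halfʳ A} {B} {C} λ a b c →
    Split-∧ʳ _ (halves-Splits A a)

  t-halves₂ : ∀ A B C → t G A B C ≡ t G A (halfˡ B) C + t G A (halfʳ B) C
  t-halves₂ A B C = t-additive {A} {B} {C} {A} {halfˡ B} {C} {A} {halfʳ B} {C} λ a b c →
    Split-∧ˡ (lookup A a) (Split-∧ʳ _ (halves-Splits B b))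

  t-halves₃ : ∀ A B C → t G A B C ≡ t G A B (halfˡ C) + t G A B (halfʳ C)
  t-halves₃ A B C = t-additive {A} {B} {C} {A} {B} {halfˡ C} {A} {B} {halfʳ C} λ a b c →
    Split-∧ˡ (lookup A a) (Split-∧ˡ (lookup B b) (Split-∧ʳ _ (halves-Splits C c)))

  t≤∣A∣∣B∣∣C∣ : ∀ A B C → t G A B C ≤ ∣ A ∣ * (∣ B ∣ * ∣ C ∣)
  t≤∣A∣∣B∣∣C∣ A B C = begin
    t G A B C                                       ≡⟨ t≡∑³ A B C ⟩
    ∑³ (λ a b c → indicator (triangle A B C a b c))
      ≤⟨ ∑³-mono-≤ (λ a b c → indicator-∧≤ (lookup A a) (lookup B b) (lookup C c) _) ⟩
    ∑³ (λ a b c → ind A a * (ind B b * ind C c))    ≡⟨ ∑³-product (ind A) (ind B) (ind C) ⟩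
    ∑ (ind A) * (∑ (ind B) * ∑ (ind C))
      ≡⟨ cong₂ _*_ (∑-indicator≡∣p∣ A) (cong₂ _*_ (∑-indicator≡∣p∣ B) (∑-indicator≡∣p∣ C)) ⟩
    ∣ A ∣ * (∣ B ∣ * ∣ C ∣)                         ∎
    where
    open ≤-Reasoning
    ind : Subset n → Fin n → ℕ
    ind p i = indicator (lookup p i)

  t-nonempty : ∀ {A B C} → t G A B C ≢ 0 → Nonempty A × Nonempty B × Nonempty C
  t-nonempty {A} {B} {C} t≢0 =
      nonempty-if-∣p∣≢0 (≢-nonZero⁻¹ ∣ A ∣ {{m*n≢0⇒m≢0 ∣ A ∣ {{∣A∣∣B∣∣C∣≢0}}}})
    , nonempty-if-∣p∣≢0 (≢-nonZero⁻¹ ∣ B ∣ {{m*n≢0⇒m≢0 ∣ B ∣ {{∣B∣∣C∣≢0}}}})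
    , nonempty-if-∣p∣≢0 (≢-nonZero⁻¹ ∣ C ∣ {{m*n≢0⇒n≢0 ∣ B ∣ {{∣B∣∣C∣≢0}}}})
    where
    ∣A∣∣B∣∣C∣≢0 : NonZero (∣ A ∣ * (∣ B ∣ * ∣ C ∣))
    ∣A∣∣B∣∣C∣≢0 = >-nonZero (<-≤-trans (n≢0⇒n>0 t≢0) (t≤∣A∣∣B∣∣C∣ A B C))
    ∣B∣∣C∣≢0 : NonZero (∣ B ∣ * ∣ C ∣)
    ∣B∣∣C∣≢0 = m*n≢0⇒n≢0 ∣ A ∣ {{∣A∣∣B∣∣C∣≢0}}

  TIS≡true⇒t≢0 : ∀ V₁ V₂ V₃ → TIS G V₁ V₂ V₃ ≡ true → t G V₁ V₂ V₃ ≢ 0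
  TIS≡true⇒t≢0 V₁ V₂ V₃ tis t≡0 with t G V₁ V₂ V₃
  TIS≡true⇒t≢0 _ _ _ () refl | zero

  TIS≡false⇒t≡0 : ∀ V₁ V₂ V₃ → TIS G V₁ V₂ V₃ ≡ false → t G V₁ V₂ V₃ ≡ 0
  TIS≡false⇒t≡0 V₁ V₂ V₃ tis with t G V₁ V₂ V₃
  TIS≡false⇒t≡0 _ _ _ tis | zero  = refl
  TIS≡false⇒t≡0 _ _ _ ()  | suc _

split-cost : ∀ k x y → x + y ≢ 0 → (1 + 2 * (k * x)) + (1 + 2 * (k * y)) ≤ 2 * (suc k * (x + y))
split-cost k x y x+y≢0 = begin
  (1 + 2 * (k * x)) + (1 + 2 * (k * y)) ≡⟨ regroup k x y ⟩
  2 * 1 + 2 * (k * (x + y))             ≤⟨ +-monoˡ-≤ _ (*-monoʳ-≤ 2 (n≢0⇒n>0 x+y≢0)) ⟩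
  2 * (x + y) + 2 * (k * (x + y))       ≡⟨ *-distribˡ-+ 2 (x + y) (k * (x + y)) ⟨
  2 * (suc k * (x + y))                 ∎
  where
  open ≤-Reasoning
  regroup : ∀ k x y → (1 + 2 * (k * x)) + (1 + 2 * (k * y)) ≡ 2 * 1 + 2 * (k * (x + y))
  regroup = solve-∀

module _ {n : ℕ} where

  infixl 1 _>>=_
  _>>=_ : Alg n → (ℕ → Alg n) → Alg n
  done v           >>= f = f v
  query V₁ V₂ V₃ k >>= f = query V₁ V₂ V₃ (λ b → k b >>= f)

  infixl 6 _⊕_
  _⊕_ : Alg n → Alg n → Alg n
  a₁ ⊕ a₂ = a₁ >>= λ v₁ → a₂ >>= λ v₂ → done (v₁ + v₂)

  mutual
    count-triangles : ℕ → ℕ → ℕ → Subset n → Subset n → Subset n → Alg n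
    count-triangles ka kb kc A B C with nonempty? A ×-dec nonempty? B ×-dec nonempty? C
    ... | yes _ = query A B C λ answer → if answer then refine ka kb kc A B C else done 0
    ... | no  _ = done 0

    refine : ℕ → ℕ → ℕ → Subset n → Subset n → Subset n → Alg n
    refine (suc ka) kb kc A B C =
      count-triangles ka kb kc (halfˡ A) B C ⊕ count-triangles ka kb kc (halfʳ A) B C
    refine zero (suc kb) kc A B C =
      count-triangles zero kb kc A (halfˡ B) C ⊕ count-triangles zero kb kc A (halfʳ B) C
    refine zero zero (suc kc) A B C =
      count-triangles zero zero kc A B (halfˡ C) ⊕ count-triangles zero zero kc A B (halfʳ C)
    refine zero zero zero A B C = done 1

module _ {n : ℕ} (G : Graph n) where

  run-query : ∀ {V₁ V₂ V₃ k v q} → legal V₁ V₂ V₃ ≡ true →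
    run G (k (TIS G V₁ V₂ V₃)) ≡ just (v , q) → run G (query V₁ V₂ V₃ k) ≡ just (v , suc q)
  run-query {V₁} {V₂} {V₃} ok e with legal V₁ V₂ V₃
  ... | true rewrite e = refl

  run-query⁻ : ∀ {V₁ V₂ V₃ k v q} → run G (query V₁ V₂ V₃ k) ≡ just (v , q) →
    legal V₁ V₂ V₃ ≡ true × ∃ λ q′ → run G (k (TIS G V₁ V₂ V₃)) ≡ just (v , q′) × q ≡ suc q′
  run-query⁻ {V₁} {V₂} {V₃} {k} e with legal V₁ V₂ V₃
  ... | true with run G (k (TIS G V₁ V₂ V₃))
  run-query⁻ refl | true | just (v , q′) = refl , q′ , refl , refl

  run->>= : ∀ a {f v q w r} → run G a ≡ just (v , q) → run G (f v) ≡ just (w , r) →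
    run G (a >>= f) ≡ just (w , q + r)
  run->>= (done v)           refl e′ = e′
  run->>= (query V₁ V₂ V₃ k) e    e′ with run-query⁻ e
  ... | ok , q′ , e-k , refl = run-query ok (run->>= (k (TIS G V₁ V₂ V₃)) e-k e′)

  record Computes (a : Alg n) (v b : ℕ) : Set where
    constructor computes
    field
      queries  : ℕ
      run≡     : run G a ≡ just (v , queries)
      queries≤ : queries ≤ b

  Computes-done : ∀ {v w b} → v ≡ w → Computes (done v) w b
  Computes-done v≡w = computes 0 (cong (λ v → just (v , 0)) v≡w) z≤n

  Computes-query : ∀ {V₁ V₂ V₃ k v b} → legal V₁ V₂ V₃ ≡ true →
    Computes (k (TIS G V₁ V₂ V₃)) v b → Computes (query V₁ V₂ V₃ k) v (suc b)
  Computes-query ok (computes q e q≤b) = computes (suc q) (run-query ok e) (s≤s q≤b)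

  Computes-⊕ : ∀ {a₁ a₂ v₁ v₂ b₁ b₂} → Computes a₁ v₁ b₁ → Computes a₂ v₂ b₂ →
    Computes (a₁ ⊕ a₂) (v₁ + v₂) (b₁ + b₂)
  Computes-⊕ {a₁} {a₂} (computes q₁ e₁ q₁≤b₁) (computes q₂ e₂ q₂≤b₂) =
    computes (q₁ + (q₂ + 0)) (run->>= a₁ e₁ (run->>= a₂ e₂ refl))
             (+-mono-≤ q₁≤b₁ (≤-trans (≤-reflexive (+-identityʳ q₂)) q₂≤b₂))

  Computes-if : ∀ b {a₁ a₂ v c} → (b ≡ true → Computes a₁ v c) → (b ≡ false → Computes a₂ v c) →
    Computes (if b then a₁ else a₂) v c
  Computes-if true  then-case else-case = then-case refl
  Computes-if false then-case else-case = else-case refl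

  Computes-⊕-halves : ∀ k {a₁ a₂ v v₁ v₂} → v ≡ v₁ + v₂ → v ≢ 0 →
    Computes a₁ v₁ (1 + 2 * (k * v₁)) → Computes a₂ v₂ (1 + 2 * (k * v₂)) →
    Computes (a₁ ⊕ a₂) v (2 * (suc k * v))
  Computes-⊕-halves k {v₁ = v₁} {v₂} refl v≢0 c₁ c₂ with Computes-⊕ c₁ c₂
  ... | computes q e q≤ = computes q e (≤-trans q≤ (split-cost k v₁ v₂ v≢0))

  open Admissible

  mutual
    count-triangles-correct : ∀ ka kb kc {A B C} → Admissible ka kb kc A B C →
      Computes (count-triangles ka kb kc A B C) (t G A B C) (1 + 2 * ((ka + kb + kc) * t G A B C))
    count-triangles-correct ka kb kc {A} {B} {C} adm
      with nonempty? A ×-dec nonempty? B ×-dec nonempty? C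
    ... | yes (a , b , c) =
      Computes-query (legal-true a b c (A#B adm) (A#C adm) (B#C adm))
        (Computes-if (TIS G A B C)
          (λ tis → refine-correct ka kb kc adm (TIS≡true⇒t≢0 G A B C tis))
          (λ tis → Computes-done (sym (TIS≡false⇒t≡0 G A B C tis))))
    ... | no ¬nonempty =
      Computes-done (sym (decidable-stable (t G A B C ≟ 0) (¬nonempty ∘ t-nonempty G)))

    refine-correct : ∀ ka kb kc {A B C} → Admissible ka kb kc A B C → t G A B C ≢ 0 →
      Computes (refine ka kb kc A B C) (t G A B C) (2 * ((ka + kb + kc) * t G A B C))
    refine-correct (suc ka) kb kc {A} {B} {C} adm t≢0 =
      Computes-⊕-halves (ka + kb + kc) (t-halves₁ G A B C) t≢0
        (count-triangles-correct ka kb kc (Admissible-halve₁ halfˡ-Halving adm))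
        (count-triangles-correct ka kb kc (Admissible-halve₁ halfʳ-Halving adm))
    refine-correct zero (suc kb) kc {A} {B} {C} adm t≢0 =
      Computes-⊕-halves (kb + kc) (t-halves₂ G A B C) t≢0
        (count-triangles-correct zero kb kc (Admissible-halve₂ halfˡ-Halving adm))
        (count-triangles-correct zero kb kc (Admissible-halve₂ halfʳ-Halving adm))
    refine-correct zero zero (suc kc) {A} {B} {C} adm t≢0 =
      Computes-⊕-halves kc (t-halves₃ G A B C) t≢0
        (count-triangles-correct zero zero kc (Admissible-halve₃ halfˡ-Halving adm))
        (count-triangles-correct zero zero kc (Admissible-halve₃ halfʳ-Halving adm))
    refine-correct zero zero zero {A} {B} {C} adm t≢0 = Computes-done (sym t≡1)
      where
      t≡1 : t G A B C ≡ 1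
      t≡1 = ≤-antisym (≤-trans (t≤∣A∣∣B∣∣C∣ G A B C) (*-mono-≤ (∣A∣≤ adm) (*-mono-≤ (∣B∣≤ adm) (∣C∣≤ adm))))
                      (n≢0⇒n>0 t≢0)

Admissible-initial : {A B C : Subset n} → Disjoint A B → Disjoint A C → Disjoint B C →
  Admissible ⌈log₂ n ⌉ ⌈log₂ n ⌉ ⌈log₂ n ⌉ A B C
Admissible-initial {n} {A} {B} {C} A#B A#C B#C = record
  { A#B = A#B ; A#C = A#C ; B#C = B#C
  ; ∣A∣≤ = ≤-trans (∣p∣≤n A) (n≤2^⌈log₂n⌉ n)
  ; ∣B∣≤ = ≤-trans (∣p∣≤n B) (n≤2^⌈log₂n⌉ n)
  ; ∣C∣≤ = ≤-trans (∣p∣≤n C) (n≤2^⌈log₂n⌉ n)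
  }

query-bound : ∀ t L → 1 + 2 * ((L + L + L) * t) ≤ 6 * ((t + 1) * (L + 1))
query-bound t L = begin
  1 + 2 * ((L + L + L) * t)                        ≤⟨ m≤m+n _ _ ⟩
  1 + 2 * ((L + L + L) * t) + (5 + 6 * t + 6 * L)  ≡⟨ expand t L ⟨
  6 * ((t + 1) * (L + 1))                          ∎
  where
  open ≤-Reasoning
  expand : ∀ t L → 6 * ((t + 1) * (L + 1)) ≡ 1 + 2 * ((L + L + L) * t) + (5 + 6 * t + 6 * L)
  expand = solve-∀

lemma4 : Σ ℕ λ c → Σ ((n : ℕ) → Subset n → Subset n → Subset n → Alg n) λ alg →
    (n : ℕ) (G : Graph n) (A B C : Subset n) →
    Disjoint A B → Disjoint A C → Disjoint B C →
    ∃ λ q → (run G (alg n A B C) ≡ just (t G A B C , q))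
      × (q ≤ c * ((t G A B C + 1) * (⌈log₂ n ⌉ + 1)))
lemma4 = 6 , (λ n → count-triangles ⌈log₂ n ⌉ ⌈log₂ n ⌉ ⌈log₂ n ⌉) , λ n G A B C A#B A#C B#C →
  let open Computes (count-triangles-correct G _ _ _ (Admissible-initial A#B A#C B#C))
  in queries , run≡ , ≤-trans queries≤ (query-bound (t G A B C) ⌈log₂ n ⌉)
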